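{- Let $G$ be a finite group, let $C$ be an inclusion-minimal generating set of $G$, and let $r\ge 1$. Then ${\it Cay}(G\times R_r, C\times R_r)={\it Cay}(G,C)[\overline K_r]$, where $\overline K_r$ denotes the edgeless graph on $r$ vertices.
   Context: A right zero semigroup is $R_r=\{r_1,\dots,r_r\}$ with multiplication $r_ir_j=r_j$; a right group is a direct product semigroup $G\times R_r$ with $G$ a group, multiplication $(g,r_i)(h,r_j)=(gh,r_j)$. For a semigroup $S$ and a subset $C\subseteq S$, the (uncolored) Cayley graph ${\it Cay}(S,C)$ is the simple undirected graph with vertex set $S$ in which distinct $s_1,s_2$ are adjacent iff $s_1c=s_2$ or $s_2c=s_1$ for some $c\in C$ (edge directions and colors are suppressed, loops and multiple edges deleted). For graphs $X,Y$, the lexicographic product $X[Y]$ has vertex set $V(X)\times V(Y)$, with $(x,y)$ adjacent to $(x',y')$ iff $x x'$ is an edge of $X$, or $x=x'$ and $yy'$ is an edge of $Y$. An inclusion-minimal generating set of $G$ is a generating set no proper subset of which generates $G$. -}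

module Defs where

open import Level using (Level; _⊔_; 0ℓ)
open import Algebra.Bundles using (Semigroup; Group)
import Algebra.Construct.DirectProduct as DP
open import Data.Nat using (ℕ)
open import Data.Fin using (Fin)
open import Data.Product using (Σ; ∃; _×_; _,_)
open import Data.Sum using (_⊎_)
open import Data.Empty using (⊥)
open import Relation.Nullary using (¬_)
open import Relation.Unary using (Pred; _⊆_)
open import Relation.Binary.PropositionalEquality as ≡ using (_≡_)
open import Function.Bundles using (Inverse; _⇔_)

private variable a ℓ p q p' : Level

IsFiniteGroup : Group a ℓ → Set (a ⊔ ℓ)
IsFiniteGroup G = Σ ℕ λ n → Inverse (≡.setoid (Fin n)) (Group.setoid G)

module _ (G : Group a ℓ) where
  open Group G

  data Generated (C : Pred Carrier p) : Pred Carrier (a ⊔ ℓ ⊔ p) where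
    gen  : ∀ {x} → C x → Generated C x
    unit : Generated C ε
    mul  : ∀ {x y} → Generated C x → Generated C y → Generated C (x ∙ y)
    inv  : ∀ {x} → Generated C x → Generated C (x ⁻¹)
    resp : ∀ {x y} → x ≈ y → Generated C x → Generated C y

  Generates : Pred Carrier p → Set (a ⊔ ℓ ⊔ p)
  Generates C = ∀ x → Generated C x

  IsMinimalGeneratingSet : ∀ {p} → Pred Carrier p → Set (a ⊔ ℓ ⊔ Level.suc p)
  IsMinimalGeneratingSet {p} C =
    Generates C × (∀ (D : Pred Carrier p) → D ⊆ C → Generates D → C ⊆ D)

rightZeroSemigroup : ℕ → Semigroup 0ℓ 0ℓ
rightZeroSemigroup r = record
  { Carrier = Fin r
  ; _≈_ = _≡_
  ; _∙_ = λ _ y → y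
  ; isSemigroup = record
    { isMagma = record
      { isEquivalence = ≡.isEquivalence
      ; ∙-cong = λ _ q → q }
    ; assoc = λ _ _ _ → ≡.refl } }

rightGroup : Group a ℓ → ℕ → Semigroup a ℓ
rightGroup G r = DP.semigroup (Group.semigroup G) (rightZeroSemigroup r)

-- Simple undirected graphs as an adjacency relation on a vertex setoid.
-- Uncolored Cayley graph Cay(S, C): distinct s₁, s₂ adjacent iff
-- s₁ c = s₂ or s₂ c = s₁ for some c ∈ C.
CayAdj : (S : Semigroup a ℓ) → Pred (Semigroup.Carrier S) p →
         Semigroup.Carrier S → Semigroup.Carrier S → Set (a ⊔ ℓ ⊔ p)
CayAdj S C s₁ s₂ =
  ¬ (s₁ ≈ s₂) × ∃ λ c → C c × ((s₁ ∙ c ≈ s₂) ⊎ (s₂ ∙ c ≈ s₁))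
  where open Semigroup S

LexAdj : {A : Set a} {B : Set q} (_≈A_ : A → A → Set ℓ) →
         (A → A → Set p) → (B → B → Set p') →
         (A × B) → (A × B) → Set (ℓ ⊔ p ⊔ p')
LexAdj _≈A_ X Y (x , y) (x' , y') = X x x' ⊎ (x ≈A x' × Y y y')

EdgelessAdj : (r : ℕ) → Fin r → Fin r → Set
EdgelessAdj r _ _ = ⊥

_×R_ : {A : Set a} → Pred A p → (r : ℕ) → Pred (A × Fin r) p
(C ×R r) (g , _) = C g

-- A minimal generating set never contains the identity: in a finite group
-- "x ≈ ε" is decidable, so the identity can be filtered out of C without
-- losing generation, and minimality then forces C to avoid it.  Hence in the
-- right group every Cayley edge (g , i) — (g c , k) moves the G-coordinate
-- (g c ≈ g would give c ≈ ε), while the R_r-coordinate k is arbitrary: this is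
-- exactly adjacency in Cay(G, C)[K̄_r].
module Submission where

open import Defs
open import Level using (Level)
open import Algebra.Bundles using (Group)
open import Algebra.Properties.Group using (identityʳ-unique)
open import Data.Nat using (ℕ; _≥_)
open import Data.Fin using (Fin)
open import Data.Fin.Properties using (_≟_)
open import Data.Product using (_×_; _,_; proj₁; proj₂)
open import Data.Sum using (inj₁; inj₂)
open import Relation.Nullary using (¬_; yes; no)
open import Relation.Nullary.Decidable using (False; via-injection; fromWitnessFalse; toWitnessFalse)
open import Relation.Unary using (Pred)
open import Relation.Binary.Definitions using (Decidable)
open import Relation.Binary.PropositionalEquality using (refl)
open import Function.Base using (_∘_)
open import Function.Bundles using (_⇔_; mk⇔)
open import Function.Properties.Inverse using (Inverse⇒Injection)
import Function.Construct.Symmetry as Symmetry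

finite⇒≈-decidable : ∀ {a ℓ} (G : Group a ℓ) → IsFiniteGroup G → Decidable (Group._≈_ G)
finite⇒≈-decidable G (_ , I) = via-injection (Inverse⇒Injection (Symmetry.inverse I)) _≟_

module _ {a ℓ} (G : Group a ℓ) (_≈?_ : Decidable (Group._≈_ G)) where
  open Group G

  -- False rather than ¬ keeps the filtered predicate at the level of C.
  withoutε : ∀ {p} → Pred Carrier p → Pred Carrier p
  withoutε C x = C x × False (x ≈? ε)

  generated-withoutε : ∀ {p} {C : Pred Carrier p} {x} →
                       Generated G C x → Generated G (withoutε C) x
  generated-withoutε (gen {y} Cy) with y ≈? ε
  ... | yes y≈ε = resp (sym y≈ε) unit
  ... | no  y≉ε = gen (Cy , fromWitnessFalse y≉ε)
  generated-withoutε unit          = unit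
  generated-withoutε (mul gx gy)   = mul (generated-withoutε gx) (generated-withoutε gy)
  generated-withoutε (inv gx)      = inv (generated-withoutε gx)
  generated-withoutε (resp x≈y gx) = resp x≈y (generated-withoutε gx)

  minimalGeneratingSet-∌ε : ∀ {p} {C : Pred Carrier p} → IsMinimalGeneratingSet G C →
                            ∀ {c} → C c → ¬ c ≈ ε
  minimalGeneratingSet-∌ε (generates , minimal) Cc =
    toWitnessFalse (proj₂ (minimal (withoutε _) proj₁ (λ x → generated-withoutε (generates x)) Cc))

module _ {a ℓ p} (G : Group a ℓ) {C : Pred (Group.Carrier G) p} where
  open Group G using (_≈_; _∙_; ε; sym; trans; semigroup)

  ≉ε⇒∙-displaces : ∀ {g c h} → ¬ c ≈ ε → g ∙ c ≈ h → ¬ g ≈ h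
  ≉ε⇒∙-displaces {g} c≉ε gc≈h g≈h = c≉ε (identityʳ-unique G g _ (trans gc≈h (sym g≈h)))

  rightGroup-cayAdj⇔lexAdj : (∀ {c} → C c → ¬ c ≈ ε) → (r : ℕ) → ∀ u v →
    CayAdj (rightGroup G r) (C ×R r) u v
      ⇔ LexAdj _≈_ (CayAdj semigroup C) (EdgelessAdj r) u v
  rightGroup-cayAdj⇔lexAdj C∌ε r (g , i) (h , j) = mk⇔ to from
    where
    to : CayAdj (rightGroup G r) (C ×R r) (g , i) (h , j) →
         LexAdj _≈_ (CayAdj semigroup C) (EdgelessAdj r) (g , i) (h , j)
    to (_ , (c , _) , Cc , inj₁ (gc≈h , _)) =
      inj₁ (≉ε⇒∙-displaces (C∌ε Cc) gc≈h , c , Cc , inj₁ gc≈h)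
    to (_ , (c , _) , Cc , inj₂ (hc≈g , _)) =
      inj₁ (≉ε⇒∙-displaces (C∌ε Cc) hc≈g ∘ sym , c , Cc , inj₂ hc≈g)

    from : LexAdj _≈_ (CayAdj semigroup C) (EdgelessAdj r) (g , i) (h , j) →
           CayAdj (rightGroup G r) (C ×R r) (g , i) (h , j)
    from (inj₁ (g≉h , c , Cc , inj₁ gc≈h)) = g≉h ∘ proj₁ , (c , j) , Cc , inj₁ (gc≈h , refl)
    from (inj₁ (g≉h , c , Cc , inj₂ hc≈g)) = g≉h ∘ proj₁ , (c , i) , Cc , inj₂ (hc≈g , refl)
    from (inj₂ (_ , ()))

lemma3p1 : ∀ {a ℓ p : Level} (G : Group a ℓ) → IsFiniteGroup G →
           (C : Pred (Group.Carrier G) p) → IsMinimalGeneratingSet G C →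
           (r : ℕ) → r ≥ 1 →
           ∀ (u v : Group.Carrier G × Fin r) →
             CayAdj (rightGroup G r) (C ×R r) u v
               ⇔ LexAdj (Group._≈_ G) (CayAdj (Group.semigroup G) C) (EdgelessAdj r) u v
lemma3p1 G finite C minimal r _ =
  rightGroup-cayAdj⇔lexAdj G
    (minimalGeneratingSet-∌ε G (finite⇒≈-decidable G finite) minimal) r
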